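{- Let $D$ be a $4$-anti-traceable oriented graph, let $P=v_1v_2\dots v_s$ be a longest anti-directed path in $D$, and let $w\in V(D)\setminus V(P)$. Then: (i) $\{w,v_2\}\not\subseteq N^+(v_1)$ and $\{w,v_2\}\not\subseteq N^-(v_1)$; $\{w,v_{s-1}\}\not\subseteq N^+(v_s)$ and $\{w,v_{s-1}\}\not\subseteq N^-(v_s)$; (ii) if $w$ is adjacent to $v_1$, then $D[\{v_1,v_2,w\}]$ is a subdigraph of a directed triangle; similarly, if $w$ is adjacent to $v_s$, then $D[\{v_{s-1},v_s,w\}]$ is a subdigraph of a directed triangle.
   Context: An oriented graph is a digraph obtained by orienting the edges of a simple undirected graph. An oriented path $x_1\dots x_p$ is anti-directed if every two consecutive arcs have opposite orientations. A digraph is anti-traceable if it has an anti-directed path through all its vertices, and $k$-anti-traceable if it has at least $k$ vertices and every induced subdigraph on $k$ vertices is anti-traceable. $N^+(v)$ and $N^-(v)$ denote out- and in-neighbourhoods; $D[X]$ is the subdigraph induced by $X$; two vertices are adjacent if there is an arc between them in either direction. A directed triangle is a directed 3-cycle. -}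

module Defs where

open import Data.Nat using (ℕ; _≤_)
open import Data.Fin using (Fin)
open import Data.Fin.Subset using (Subset; _∈_; ∣_∣)
open import Data.Bool using (Bool; true; false)
open import Data.List using (List; []; _∷_; length)
open import Data.List.Relation.Unary.All using (All)
open import Data.List.Relation.Unary.Unique.Propositional using (Unique)
open import Data.Product using (_×_; Σ; ∃)
open import Data.Sum using (_⊎_)
open import Data.Unit using (⊤)
open import Relation.Binary.PropositionalEquality using (_≡_)
open import Relation.Nullary using (¬_)

record OrientedGraph (n : ℕ) : Set where
  field
    arc       : Fin n → Fin n → Bool
    loopless  : ∀ x → arc x x ≡ false
    oriented  : ∀ x y → arc x y ≡ true → arc y x ≡ false
open OrientedGraph public

module _ {n : ℕ} (D : OrientedGraph n) where

  Arc : Fin n → Fin n → Set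
  Arc x y = arc D x y ≡ true

  Adjacent : Fin n → Fin n → Set
  Adjacent x y = Arc x y ⊎ Arc y x

  Opposite : Fin n → Fin n → Fin n → Set
  Opposite x y z = (Arc x y × Arc z y) ⊎ (Arc y x × Arc y z)

  AntiWalk : List (Fin n) → Set
  AntiWalk []                = ⊤
  AntiWalk (x ∷ [])          = ⊤
  AntiWalk (x ∷ y ∷ [])      = Adjacent x y
  AntiWalk (x ∷ y ∷ z ∷ xs)  = Opposite x y z × AntiWalk (y ∷ z ∷ xs)

  AntiPath : List (Fin n) → Set
  AntiPath P = Unique P × AntiWalk P × 1 ≤ length P

  KAntiTraceable : ℕ → Set
  KAntiTraceable k =
    k ≤ n ×
    (∀ (S : Subset n) → ∣ S ∣ ≡ k →
       ∃ λ (P : List (Fin n)) → AntiPath P × length P ≡ k × All (_∈ S) P)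

  LongestAntiPath : List (Fin n) → Set
  LongestAntiPath P = AntiPath P × (∀ Q → AntiPath Q → length Q ≤ length P)

  TriArc : Fin n → Fin n → Fin n → Fin n → Fin n → Set
  TriArc a b c x y = (x ≡ a × y ≡ b) ⊎ (x ≡ b × y ≡ c) ⊎ (x ≡ c × y ≡ a)

  InTriple : Fin n → Fin n → Fin n → Fin n → Set
  InTriple a b c x = x ≡ a ⊎ x ≡ b ⊎ x ≡ c

  SubDirTriangle : Fin n → Fin n → Fin n → Set
  SubDirTriangle a b c =
    (∀ x y → InTriple a b c x → InTriple a b c y → Arc x y → TriArc a b c x y)
    ⊎
    (∀ x y → InTriple a b c x → InTriple a b c y → Arc x y → TriArc a c b x y)

-- Neither w P nor v₁ w v₂ … v_s may be an anti-directed path, since either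
-- would be longer than P.  The first is an anti-directed path exactly when w
-- and v₂ are both out- or both in-neighbours of v₁, which gives (i).  If w is
-- adjacent to v₁, then by (i) v₁ lies on a directed 2-path between w and v₂;
-- an arc between w and v₂ against that direction would make v₁ w v₂ … v_s
-- anti-directed, so every arc of D[{v₁,v₂,w}] follows one cyclic order, which
-- gives (ii).  The statements at v_s follow by reversing P.
module Submission where

open import Defs
open import Data.Nat using (ℕ; _≤_; s≤s; z≤n)
open import Data.Nat.Properties using (1+n≰n)
open import Data.Fin using (Fin)
open import Data.List using (List; []; _∷_; _++_; length; reverse)
open import Data.List.Properties using (reverse-++; length-reverse)
open import Data.List.Membership.Propositional using (_∈_; _∉_)
open import Data.List.Relation.Unary.All.Properties using (¬Any⇒All¬)
open import Data.List.Relation.Unary.AllPairs using (_∷_)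
open import Data.List.Relation.Binary.Permutation.Propositional
  using (_↭_; refl; swap; ↭-sym; ↭⇒↭ₛ)
open import Data.List.Relation.Binary.Permutation.Propositional.Properties
  using (↭-length; ↭-reverse; ∈-resp-↭)
open import Data.List.Relation.Binary.Permutation.Setoid.Properties using (Unique-resp-↭)
open import Data.Product using (_×_; _,_)
open import Data.Sum using (_⊎_; inj₁; inj₂; [_,_]′)
open import Data.Unit using (tt)
open import Data.Empty using (⊥-elim)
open import Relation.Binary.PropositionalEquality
  using (_≡_; refl; sym; trans; subst; setoid)
open import Relation.Nullary using (¬_)
open import Function using (_∘_)

module _ {n : ℕ} (D : OrientedGraph n) where

  Arc-irrefl : ∀ {x} → ¬ Arc D x x
  Arc-irrefl {x} x→x with trans (sym x→x) (loopless D x)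
  ... | ()

  Arc-asym : ∀ {x y} → Arc D x y → ¬ Arc D y x
  Arc-asym {x} {y} x→y y→x with trans (sym y→x) (oriented D x y x→y)
  ... | ()

  Adjacent-sym : ∀ {x y} → Adjacent D x y → Adjacent D y x
  Adjacent-sym (inj₁ x→y) = inj₂ x→y
  Adjacent-sym (inj₂ y→x) = inj₁ y→x

  Opposite-sym : ∀ {x y z} → Opposite D x y z → Opposite D z y x
  Opposite-sym (inj₁ (x→y , z→y)) = inj₁ (z→y , x→y)
  Opposite-sym (inj₂ (y→x , y→z)) = inj₂ (y→z , y→x)

  Opposite-trans : ∀ {x y z t} → Opposite D x y z → Opposite D z y t → Opposite D x y t
  Opposite-trans (inj₁ (x→y , _))   (inj₁ (_ , t→y)) = inj₁ (x→y , t→y)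
  Opposite-trans (inj₁ (_ , z→y))   (inj₂ (y→z , _)) = ⊥-elim (Arc-asym z→y y→z)
  Opposite-trans (inj₂ (_ , y→z))   (inj₁ (z→y , _)) = ⊥-elim (Arc-asym z→y y→z)
  Opposite-trans (inj₂ (y→x , _))   (inj₂ (_ , y→t)) = inj₂ (y→x , y→t)

  Opposite⇒Adjacentˡ : ∀ {x y z} → Opposite D x y z → Adjacent D x y
  Opposite⇒Adjacentˡ (inj₁ (x→y , _)) = inj₁ x→y
  Opposite⇒Adjacentˡ (inj₂ (y→x , _)) = inj₂ y→x

  Opposite⇒Adjacentʳ : ∀ {x y z} → Opposite D x y z → Adjacent D y z
  Opposite⇒Adjacentʳ o = Adjacent-sym (Opposite⇒Adjacentˡ (Opposite-sym o))

  AntiWalk-head : ∀ {x y} xs → AntiWalk D (x ∷ y ∷ xs) → Adjacent D x y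
  AntiWalk-head []      adj      = adj
  AntiWalk-head (_ ∷ _) (o , _)  = Opposite⇒Adjacentˡ o

  AntiWalk-insert : ∀ {x y z} xs → AntiWalk D (x ∷ y ∷ xs) →
    Opposite D x z y → Opposite D x y z → AntiWalk D (x ∷ z ∷ y ∷ xs)
  AntiWalk-insert []      _              xzy _   = xzy , Opposite⇒Adjacentʳ xzy
  AntiWalk-insert (_ ∷ _) (xyt , walk)   xzy xyz =
    xzy , Opposite-trans (Opposite-sym xyz) xyt , walk

  AntiWalk-snoc : ∀ {y z t} xs → AntiWalk D (xs ++ y ∷ z ∷ []) →
    Opposite D y z t → AntiWalk D (xs ++ y ∷ z ∷ t ∷ [])
  AntiWalk-snoc []                _            yzt = yzt , Opposite⇒Adjacentʳ yzt
  AntiWalk-snoc (_ ∷ [])          (o , _)      yzt = o , yzt , Opposite⇒Adjacentʳ yzt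
  AntiWalk-snoc (_ ∷ b ∷ [])      (o , walk)   yzt = o , AntiWalk-snoc (b ∷ []) walk yzt
  AntiWalk-snoc (_ ∷ b ∷ c ∷ xs)  (o , walk)   yzt = o , AntiWalk-snoc (b ∷ c ∷ xs) walk yzt

  AntiWalk-reverse : ∀ xs → AntiWalk D xs → AntiWalk D (reverse xs)
  AntiWalk-reverse []            _           = tt
  AntiWalk-reverse (_ ∷ [])      _           = tt
  AntiWalk-reverse (_ ∷ _ ∷ [])  adj         = Adjacent-sym adj
  AntiWalk-reverse (x ∷ y ∷ z ∷ xs) (o , walk) =
    subst (AntiWalk D) (sym (reverse-++ (x ∷ y ∷ z ∷ []) xs))
      (AntiWalk-snoc (reverse xs)
        (subst (AntiWalk D) (reverse-++ (y ∷ z ∷ []) xs) (AntiWalk-reverse (y ∷ z ∷ xs) walk))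
        (Opposite-sym o))

  LongestAntiPath-reverse : ∀ {P} → LongestAntiPath D P → LongestAntiPath D (reverse P)
  LongestAntiPath-reverse {P} ((unique , walk , nonempty) , longest) =
    ( Unique-resp-↭ (setoid (Fin n)) (↭⇒↭ₛ (↭-sym (↭-reverse P))) unique
    , AntiWalk-reverse P walk
    , subst (1 ≤_) (sym (length-reverse P)) nonempty )
    , λ Q path → subst (length Q ≤_) (sym (length-reverse P)) (longest Q path)

  LongestAntiPath-unextendable : ∀ {P w Q} → LongestAntiPath D P → w ∉ P →
    Q ↭ w ∷ P → ¬ AntiWalk D Q
  LongestAntiPath-unextendable {P} {w} {Q} ((unique , _) , longest) w∉P Q↭wP walk =
    1+n≰n (subst (_≤ length P) (↭-length Q↭wP) (longest Q Q-path))
    where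
    Q-path : AntiPath D Q
    Q-path = Unique-resp-↭ (setoid (Fin n)) (↭⇒↭ₛ (↭-sym Q↭wP)) (¬Any⇒All¬ P w∉P ∷ unique)
           , walk
           , subst (1 ≤_) (sym (↭-length Q↭wP)) (s≤s z≤n)

  CyclicallyOriented : Fin n → Fin n → Fin n → Set
  CyclicallyOriented a b c = ¬ Arc D b a × ¬ Arc D c b × ¬ Arc D a c

  CyclicallyOriented-rotate : ∀ {a b c} →
    CyclicallyOriented a b c → CyclicallyOriented b c a
  CyclicallyOriented-rotate (b↛a , c↛b , a↛c) = c↛b , a↛c , b↛a

  CyclicallyOriented⇒TriArc : ∀ {a b c} → CyclicallyOriented a b c →
    ∀ x y → InTriple D a b c x → InTriple D a b c y → Arc D x y → TriArc D a b c x y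
  CyclicallyOriented⇒TriArc _             _ _ (inj₁ refl)        (inj₁ refl)        x→x = ⊥-elim (Arc-irrefl x→x)
  CyclicallyOriented⇒TriArc _             _ _ (inj₁ refl)        (inj₂ (inj₁ refl)) _   = inj₁ (refl , refl)
  CyclicallyOriented⇒TriArc (_ , _ , a↛c) _ _ (inj₁ refl)        (inj₂ (inj₂ refl)) a→c = ⊥-elim (a↛c a→c)
  CyclicallyOriented⇒TriArc (b↛a , _ , _) _ _ (inj₂ (inj₁ refl)) (inj₁ refl)        b→a = ⊥-elim (b↛a b→a)
  CyclicallyOriented⇒TriArc _             _ _ (inj₂ (inj₁ refl)) (inj₂ (inj₁ refl)) x→x = ⊥-elim (Arc-irrefl x→x)
  CyclicallyOriented⇒TriArc _             _ _ (inj₂ (inj₁ refl)) (inj₂ (inj₂ refl)) _   = inj₂ (inj₁ (refl , refl))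
  CyclicallyOriented⇒TriArc _             _ _ (inj₂ (inj₂ refl)) (inj₁ refl)        _   = inj₂ (inj₂ (refl , refl))
  CyclicallyOriented⇒TriArc (_ , c↛b , _) _ _ (inj₂ (inj₂ refl)) (inj₂ (inj₁ refl)) c→b = ⊥-elim (c↛b c→b)
  CyclicallyOriented⇒TriArc _             _ _ (inj₂ (inj₂ refl)) (inj₂ (inj₂ refl)) x→x = ⊥-elim (Arc-irrefl x→x)

  InTriple-swap : ∀ {a b c x} → InTriple D a b c x → InTriple D a c b x
  InTriple-swap (inj₁ x≡a)        = inj₁ x≡a
  InTriple-swap (inj₂ (inj₁ x≡b)) = inj₂ (inj₂ x≡b)
  InTriple-swap (inj₂ (inj₂ x≡c)) = inj₂ (inj₁ x≡c)

  CyclicallyOriented⇒SubDirTriangle : ∀ {a b c} →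
    CyclicallyOriented a b c ⊎ CyclicallyOriented a c b → SubDirTriangle D a b c
  CyclicallyOriented⇒SubDirTriangle (inj₁ abc) = inj₁ (CyclicallyOriented⇒TriArc abc)
  CyclicallyOriented⇒SubDirTriangle (inj₂ acb) =
    inj₂ λ x y x∈ y∈ → CyclicallyOriented⇒TriArc acb x y (InTriple-swap x∈) (InTriple-swap y∈)

  unextendable-triple-cyclic : ∀ {v₁ v₂ w} → Adjacent D v₁ v₂ → Adjacent D w v₁ →
    ¬ Opposite D w v₁ v₂ → ¬ (Opposite D v₁ w v₂ × Opposite D v₁ v₂ w) →
    CyclicallyOriented v₁ v₂ w ⊎ CyclicallyOriented v₁ w v₂
  unextendable-triple-cyclic (inj₁ v₁→v₂) (inj₂ v₁→w) no-prepend _ =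
    ⊥-elim (no-prepend (inj₂ (v₁→w , v₁→v₂)))
  unextendable-triple-cyclic (inj₂ v₂→v₁) (inj₁ w→v₁) no-prepend _ =
    ⊥-elim (no-prepend (inj₁ (w→v₁ , v₂→v₁)))
  unextendable-triple-cyclic (inj₁ v₁→v₂) (inj₁ w→v₁) _ no-insert =
    inj₁ ( Arc-asym v₁→v₂
         , (λ w→v₂ → no-insert (inj₂ (w→v₁ , w→v₂) , inj₁ (v₁→v₂ , w→v₂)))
         , Arc-asym w→v₁ )
  unextendable-triple-cyclic (inj₂ v₂→v₁) (inj₂ v₁→w) _ no-insert =
    inj₂ ( Arc-asym v₁→w
         , (λ v₂→w → no-insert (inj₁ (v₁→w , v₂→w) , inj₂ (v₂→v₁ , v₂→w)))
         , Arc-asym v₂→v₁ )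

  LongestAntiPath-start : ∀ {v₁ v₂ rest w} → LongestAntiPath D (v₁ ∷ v₂ ∷ rest) →
    w ∉ v₁ ∷ v₂ ∷ rest →
    ¬ Opposite D w v₁ v₂ × (Adjacent D w v₁ → CyclicallyOriented v₁ v₂ w ⊎ CyclicallyOriented v₁ w v₂)
  LongestAntiPath-start {v₁} {v₂} {rest} {w} longest@((_ , walk , _) , _) w∉P =
    no-prepend , cyclic
    where
    no-prepend : ¬ Opposite D w v₁ v₂
    no-prepend o = LongestAntiPath-unextendable longest w∉P refl (o , walk)

    no-insert : ¬ (Opposite D v₁ w v₂ × Opposite D v₁ v₂ w)
    no-insert (v₁wv₂ , v₁v₂w) = LongestAntiPath-unextendable longest w∉P (swap v₁ w refl)
      (AntiWalk-insert rest walk v₁wv₂ v₁v₂w)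

    cyclic : Adjacent D w v₁ → CyclicallyOriented v₁ v₂ w ⊎ CyclicallyOriented v₁ w v₂
    cyclic adj = unextendable-triple-cyclic (AntiWalk-head rest walk) adj no-prepend no-insert

  LongestAntiPath-end : ∀ {pre u v w} → LongestAntiPath D (pre ++ u ∷ v ∷ []) →
    w ∉ pre ++ u ∷ v ∷ [] →
    ¬ Opposite D w v u × (Adjacent D w v → CyclicallyOriented u v w ⊎ CyclicallyOriented u w v)
  LongestAntiPath-end {pre} {u} {v} {w} longest w∉P with
    LongestAntiPath-start (subst (LongestAntiPath D) reverse-P (LongestAntiPath-reverse longest))
      (λ w∈ → w∉P (∈-resp-↭ (↭-reverse P) (subst (w ∈_) (sym reverse-P) w∈)))
    where
    P = pre ++ u ∷ v ∷ []
    reverse-P : reverse P ≡ v ∷ u ∷ reverse pre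
    reverse-P = reverse-++ pre (u ∷ v ∷ [])
  ... | no-prepend , cyclic =
    no-prepend , λ adj → [ inj₂ ∘ rotate , inj₁ ∘ rotate ∘ rotate ]′ (cyclic adj)
    where
    rotate : ∀ {a b c} → CyclicallyOriented a b c → CyclicallyOriented b c a
    rotate = CyclicallyOriented-rotate

mainTheorem5 : ∀ {n : ℕ} (D : OrientedGraph n) → KAntiTraceable D 4 →
    (P : List (Fin n)) → LongestAntiPath D P → (w : Fin n) → w ∉ P →
    (∀ v₁ v₂ rest → P ≡ v₁ ∷ v₂ ∷ rest →
    ¬ (Arc D v₁ w × Arc D v₁ v₂) × ¬ (Arc D w v₁ × Arc D v₂ v₁)
    × (Adjacent D w v₁ → SubDirTriangle D v₁ v₂ w))
    × (∀ pre u v → P ≡ pre ++ (u ∷ v ∷ []) →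
    ¬ (Arc D v w × Arc D v u) × ¬ (Arc D w v × Arc D u v)
    × (Adjacent D w v → SubDirTriangle D u v w))
mainTheorem5 D _ P longest w w∉P =
  (λ { _ _ _ refl → conclusions (LongestAntiPath-start D longest w∉P) }) ,
  (λ { _ _ _ refl → conclusions (LongestAntiPath-end D longest w∉P) })
  where
  conclusions : ∀ {x y a b c} → ¬ Opposite D w x y ×
      (Adjacent D w x → CyclicallyOriented D a b c ⊎ CyclicallyOriented D a c b) →
    ¬ (Arc D x w × Arc D x y) × ¬ (Arc D w x × Arc D y x) × (Adjacent D w x → SubDirTriangle D a b c)
  conclusions (no-prepend , cyclic) =
    no-prepend ∘ inj₂ , no-prepend ∘ inj₁ , CyclicallyOriented⇒SubDirTriangle D ∘ cyclic
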